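{- For every integer $n\geq 0$, the number of Fishburn permutations of length $n$ that simultaneously avoid the classical patterns $321$, $3142$ and $2143$ equals $\binom{n}{2}+1$.
   Context: A permutation of length $n$ is a rearrangement $\pi=\pi_1\cdots\pi_n$ of $[n]$ (for $n=0$ there is exactly one, the empty permutation). A permutation $\pi$ contains a classical pattern $p\in S_k$ if some subsequence of $\pi$ of length $k$ is order-isomorphic to $p$; otherwise it avoids $p$. A Fishburn permutation is a permutation $\pi$ for which there are no indices $i<j$ with $\pi_j<\pi_i<\pi_{i+1}$ and $\pi_i=\pi_j+1$. -}

module Defs where

open import Data.Nat using (ℕ; zero; suc; _+_; _<_)
open import Data.Nat.Combinatorics using (_C_)
open import Data.Fin using (Fin; toℕ; inject₁) renaming (suc to fsuc; zero to fzero)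
open import Data.Vec using (Vec; lookup; []; _∷_)
open import Data.List using (List; length)
open import Data.List.Membership.Propositional using (_∈_)
open import Data.List.Relation.Unary.Unique.Propositional using (Unique)
open import Data.Product using (Σ; ∃; _×_; _,_)
open import Relation.Binary.PropositionalEquality using (_≡_)
open import Relation.Nullary using (¬_)
open import Function.Definitions using (Injective)
open import Function.Bundles using (_⇔_)

-- A permutation of length n: a word π = π₁⋯πₙ over [n] = Fin n
-- (values 0..n-1 stand for 1..n) whose letters are pairwise distinct.
IsPerm : (n : ℕ) → Vec (Fin n) n → Set
IsPerm n π = Injective _≡_ _≡_ (lookup π)

val : {n : ℕ} → Vec (Fin n) n → Fin n → ℕ
val π i = toℕ (lookup π i)

Contains : {n k : ℕ} → Vec (Fin n) n → Vec (Fin k) k → Set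
Contains {n} {k} π p =
  Σ (Fin k → Fin n) λ f →
    ((a b : Fin k) → toℕ a < toℕ b → toℕ (f a) < toℕ (f b)) ×
    ((a b : Fin k) → (val π (f a) < val π (f b)) ⇔ (toℕ (lookup p a) < toℕ (lookup p b)))

Avoids : {n k : ℕ} → Vec (Fin n) n → Vec (Fin k) k → Set
Avoids π p = ¬ Contains π p

-- Fishburn: no indices i < j with π_j < π_i < π_{i+1} and π_i = π_j + 1.
-- Position i has a successor i+1, so i ranges over Fin m when n = suc m:
-- position i is inject₁ i and position i+1 is fsuc i.
Fishburn : {n : ℕ} → Vec (Fin n) n → Set
Fishburn {zero} π = Data.Unit.⊤
  where import Data.Unit
Fishburn {suc m} π =
  (i : Fin m) (j : Fin (suc m)) →
    toℕ (inject₁ i) < toℕ j →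
    val π j < val π (inject₁ i) →
    val π (inject₁ i) < val π (fsuc i) →
    val π (inject₁ i) ≡ val π j + 1 → Data.Empty.⊥
  where import Data.Empty

p321 : Vec (Fin 3) 3
p321 = fsuc (fsuc fzero) ∷ fsuc fzero ∷ fzero ∷ []

p3142 : Vec (Fin 4) 4
p3142 = fsuc (fsuc fzero) ∷ fzero ∷ fsuc (fsuc (fsuc fzero)) ∷ fsuc fzero ∷ []

p2143 : Vec (Fin 4) 4
p2143 = fsuc fzero ∷ fzero ∷ fsuc (fsuc (fsuc fzero)) ∷ fsuc (fsuc fzero) ∷ []

Good : (n : ℕ) → Vec (Fin n) n → Set
Good n π = IsPerm n π × Fishburn π × Avoids π p321 × Avoids π p3142 × Avoids π p2143

-- "the number of π satisfying P is N": some duplicate-free list enumerates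
-- exactly the π satisfying P, and it has length N.
HasCount : {A : Set} → (A → Set) → ℕ → Set
HasCount {A} P N =
  Σ (List A) λ xs → Unique xs × ((x : A) → (x ∈ xs) ⇔ P x) × (length xs ≡ N)

-- Write a permutation of length n as its entry function g on positions 0, …, n-1, and let
-- rotate a b (for a ≤ b) be the identity with the segment a, …, b rotated one step to the right,
-- so that the entry b moves to position a.  Every inversion of rotate a b starts at position a, and
-- position a is followed by a smaller entry; since 321, 3142 and 2143 each contain two inversions
-- with different left ends, rotate a b avoids them and is Fishburn.
--
-- Conversely, let g be good and not the identity, let k be the largest position it moves and p the
-- position of the entry k, so p < k and g fixes everything after k.  Avoiding 321 makes g ascending
-- on (p, k]; together with the entry g k, avoiding 321, 3142 and 2143 makes g ascending on [0, p).
-- The Fishburn condition then shows that every entry before p is smaller than every entry in (p, k]: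
-- for a counterexample with g i = x + 1, the entry x sits either in (p, k], contradicting the
-- condition at i, or before p, giving a smaller counterexample.  So g with position p deleted is an
-- increasing map of {0, …, k-1} into itself, hence the identity, and g = rotate p k.  The good
-- permutations are therefore the identity and the rotate a b with a < b < n: C(n,2) + 1 of them.

module Submission where

open import Data.Nat using (ℕ; zero; suc; pred; _+_; _<_; _≤_; z≤n; s≤s; >-nonZero)
open import Data.Nat.Properties
open import Data.Nat.Combinatorics using (_C_; nCk+nC[k+1]≡[n+1]C[k+1]; nC1≡n)
open import Data.Fin using (Fin; toℕ; fromℕ<; inject₁; punchOut; #_)
  renaming (suc to fsuc; _<_ to _<ᶠ_)
open import Data.Fin.Properties
  using ( toℕ-fromℕ<; fromℕ<-toℕ; toℕ-injective; toℕ<n; toℕ-inject₁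
        ; any?; injective⇒≤; punchOut-injective)
  renaming (_≟_ to _≟ᶠ_; <-cmp to <ᶠ-cmp)
open import Data.Vec using (Vec; lookup; tabulate; []; _∷_)
import Data.Vec as Vec
open import Data.Vec.Properties using (lookup∘tabulate; lookup-map; tabulate∘lookup; tabulate-cong)
open import Data.Vec.Relation.Unary.All using ([]; _∷_) renaming (All to AllV)
import Data.Vec.Relation.Unary.All.Properties as AllV
open import Data.Vec.Relation.Unary.Linked using (Linked; [-]; _∷_)
import Data.Vec.Relation.Unary.Linked.Properties as Linked
open import Data.List using (List; length; map; _++_; upTo) renaming ([] to []ₗ; _∷_ to _∷ₗ_)
open import Data.List.Properties using (length-map; length-++; length-upTo)
open import Data.List.Membership.Propositional using (_∈_)
open import Data.List.Membership.Propositional.Properties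
  using (∈-map⁺; ∈-map⁻; ∈-++⁺ˡ; ∈-++⁺ʳ; ∈-++⁻; ∈-upTo⁺; ∈-upTo⁻)
open import Data.List.Relation.Unary.Any using (here; there)
import Data.List.Relation.Unary.All as All
open import Data.List.Relation.Unary.AllPairs using ([]; _∷_)
open import Data.List.Relation.Unary.Unique.Propositional using (Unique)
import Data.List.Relation.Unary.Unique.Propositional.Properties as Unique
open import Data.Empty using (⊥; ⊥-elim)
open import Data.Unit using (tt)
open import Data.Sum using (_⊎_; inj₁; inj₂)
open import Data.Product using (∃; _×_; _,_; proj₁; proj₂; uncurry)
open import Data.Product.Function.NonDependent.Propositional using (_×-⇔_)
open import Relation.Nullary using (¬_; yes; no)
open import Relation.Nullary.Decidable using (decidable-stable)
open import Relation.Binary.Definitions using (tri<; tri≈; tri>)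
open import Relation.Binary.PropositionalEquality
open import Function.Base using (_∘_)
open import Function.Bundles using (_⇔_; mk⇔; Equivalence)
open import Function.Definitions using (Injective)

open import Defs

private
  variable
    N a b i j : ℕ

module _ {m : ℕ} {f : ℕ → ℕ} (increasing : ∀ {i j} → i < j → j < m → f i < f j)
         (bounded : ∀ {i} → i < m → f i < m) where

  private
    ≤-image : i < m → i ≤ f i
    ≤-image {zero}  _     = z≤n
    ≤-image {suc i} i+1<m =
      ≤-<-trans (≤-image (<-trans (n<1+n i) i+1<m)) (increasing (n<1+n i) i+1<m)

    room-above-image : ∀ d → i + d < m → f i + d < m
    room-above-image {i} zero i<m
      rewrite +-identityʳ i | +-identityʳ (f i) = bounded i<m
    room-above-image {i} (suc d) i+d+1<m
      rewrite +-suc i d | +-suc (f i) d =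
      ≤-<-trans (+-monoˡ-≤ d (increasing (n<1+n i) i+1<m)) (room-above-image d i+d+1<m)
      where
      i+1<m : suc i < m
      i+1<m = ≤-<-trans (s≤s (m≤m+n i d)) i+d+1<m

  increasing-endo⇒id : i < m → f i ≡ i
  increasing-endo⇒id {i} i<m with m≤n⇒∃[o]m+o≡n i<m
  ... | d , refl =
    ≤-antisym (+-cancelʳ-≤ d (f i) i (≤-pred (room-above-image d ≤-refl))) (≤-image i<m)

injective⇒surjective : ∀ {n} {f : Fin n → Fin n} →
                       Injective _≡_ _≡_ f → ∀ y → ∃ λ x → f x ≡ y
injective⇒surjective {suc n} {f} f-inj y with any? (λ x → f x ≟ᶠ y)
... | yes hit = hit
... | no miss = ⊥-elim (<-irrefl refl (injective⇒≤ squeeze-injective))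
  where
  y≢f : ∀ x → y ≢ f x
  y≢f x y≡fx = miss (x , sym y≡fx)
  squeeze : Fin (suc n) → Fin n
  squeeze x = punchOut (y≢f x)
  squeeze-injective : Injective _≡_ _≡_ squeeze
  squeeze-injective {x} {x′} = f-inj ∘ punchOut-injective (y≢f x) (y≢f x′)

unique-map⁺ : ∀ {A B : Set} (f : A → B) {xs : List A} →
              (∀ {x y} → x ∈ xs → y ∈ xs → f x ≡ f y → x ≡ y) →
              Unique xs → Unique (map f xs)
unique-map⁺ f           injective []                = []
unique-map⁺ f {x ∷ₗ xs} injective (x∉xs ∷ xs-unique) =
  All.tabulate fx∉ ∷ unique-map⁺ f (λ x∈ y∈ → injective (there x∈) (there y∈)) xs-unique
  where
  fx∉ : ∀ {z} → z ∈ map f xs → f x ≢ z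
  fx∉ z∈ fx≡z with y , y∈xs , refl ← ∈-map⁻ f z∈ =
    All.lookup x∉xs y∈xs (injective (here refl) (there y∈xs) fx≡z)

Ascending : ∀ {k} → Vec ℕ k → Set
Ascending = Linked _<_

lookup-<⇔ : ∀ {k} {xs : Vec ℕ k} → Ascending xs →
            ∀ {x y} → (lookup xs x < lookup xs y) ⇔ (x <ᶠ y)
lookup-<⇔ {xs = xs} xs↗ {x} {y} = mk⇔ to (Linked.lookup⁺ <-trans xs↗)
  where
  to : lookup xs x < lookup xs y → x <ᶠ y
  to xsₓ<xsᵧ with <ᶠ-cmp x y
  ... | tri< x<y _ _  = x<y
  ... | tri≈ _ refl _ = ⊥-elim (<-irrefl refl xsₓ<xsᵧ)
  ... | tri> _ _ y<x  = ⊥-elim (<-asym xsₓ<xsᵧ (Linked.lookup⁺ <-trans xs↗ y<x))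

skip : ℕ → ℕ → ℕ
skip p i with i <? p
... | yes _ = i
... | no  _ = suc i

skip-below : ∀ {p} → i < p → skip p i ≡ i
skip-below {i} {p} i<p with i <? p
... | yes _   = refl
... | no  i≮p = ⊥-elim (i≮p i<p)

skip-above : ∀ {p} → p ≤ i → skip p i ≡ suc i
skip-above {i} {p} p≤i with i <? p
... | yes i<p = ⊥-elim (<⇒≱ i<p p≤i)
... | no  _   = refl

skip-≢ : ∀ p i → skip p i ≢ p
skip-≢ p i with i <? p
... | yes i<p = <⇒≢ i<p
... | no  i≮p = λ { refl → i≮p (n<1+n i) }

skip-≤ : ∀ p i → skip p i ≤ suc i
skip-≤ p i with i <? p
... | yes _ = n≤1+n i
... | no  _ = ≤-refl

skip-< : ∀ p → i < j → skip p i < skip p j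
skip-< {i} {j} p i<j with i <? p | j <? p
... | yes _   | yes _   = i<j
... | yes _   | no  _   = <-trans i<j (n<1+n j)
... | no  i≮p | yes j<p = ⊥-elim (i≮p (<-trans i<j j<p))
... | no  _   | no  _   = s≤s i<j

data Region (a b i : ℕ) : Set where
  before  : i < a → Region a b i
  source  : i ≡ a → Region a b i
  shifted : a < i → i ≤ b → Region a b i
  after   : a < i → b < i → Region a b i

region : ∀ a b i → Region a b i
region a b i with <-cmp i a
... | tri< i<a _ _ = before i<a
... | tri≈ _ i≡a _ = source i≡a
... | tri> _ _ a<i with i ≤? b
...   | yes i≤b = shifted a<i i≤b
...   | no  i≰b = after a<i (≰⇒> i≰b)

rotate : ℕ → ℕ → ℕ → ℕ
rotate a b i with region a b i
... | before _    = i
... | source _    = b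
... | shifted _ _ = pred i
... | after _ _   = i

rotate-before : i < a → rotate a b i ≡ i
rotate-before {i} {a} {b} i<a with region a b i
... | before _      = refl
... | source i≡a    = ⊥-elim (<-irrefl i≡a i<a)
... | shifted a<i _ = ⊥-elim (<-asym i<a a<i)
... | after a<i _   = ⊥-elim (<-asym i<a a<i)

rotate-source : rotate a b a ≡ b
rotate-source {a} {b} with region a b a
... | before a<a    = ⊥-elim (<-irrefl refl a<a)
... | source _      = refl
... | shifted a<a _ = ⊥-elim (<-irrefl refl a<a)
... | after a<a _   = ⊥-elim (<-irrefl refl a<a)

rotate-shifted : a < i → i ≤ b → rotate a b i ≡ pred i
rotate-shifted {a} {i} {b} a<i i≤b with region a b i
... | before i<a    = ⊥-elim (<-asym i<a a<i)
... | source i≡a    = ⊥-elim (<-irrefl (sym i≡a) a<i)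
... | shifted _ _   = refl
... | after _ b<i   = ⊥-elim (<⇒≱ b<i i≤b)

rotate-self : rotate a a i ≡ i
rotate-self {a} {i} with region a a i
... | before _        = refl
... | source i≡a      = sym i≡a
... | shifted a<i i≤a = ⊥-elim (<⇒≱ a<i i≤a)
... | after _ _       = refl

rotate-< : b < N → i < N → rotate a b i < N
rotate-< {b} {N} {i} {a} b<N i<N with region a b i
... | before _    = i<N
... | source _    = b<N
... | shifted _ _ = ≤-<-trans pred[n]≤n i<N
... | after _ _   = i<N

rotate-increasing : a ≤ b → i < j → i ≢ a → rotate a b i < rotate a b j
rotate-increasing {a} {b} {i} {j} a≤b i<j i≢a with region a b i | region a b j
... | before _        | before _        = i<j
... | before i<a      | source _        = <-≤-trans i<a a≤b
... | before i<a      | shifted a<j _   = <-≤-trans i<a (<⇒≤pred a<j)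
... | before _        | after _ _       = i<j
... | source i≡a      | _               = ⊥-elim (i≢a i≡a)
... | shifted a<i _   | before j<a      = ⊥-elim (<-asym a<i (<-trans i<j j<a))
... | shifted a<i _   | source j≡a      = ⊥-elim (<-asym a<i (subst (i <_) j≡a i<j))
... | shifted a<i _   | shifted _ _     = pred-mono-< {{>-nonZero (≤-<-trans z≤n a<i)}} i<j
... | shifted _ _     | after _ _       = ≤-<-trans pred[n]≤n i<j
... | after a<i _     | before j<a      = ⊥-elim (<-asym a<i (<-trans i<j j<a))
... | after a<i _     | source j≡a      = ⊥-elim (<-asym a<i (subst (i <_) j≡a i<j))
... | after _ b<i     | shifted _ j≤b   = ⊥-elim (<⇒≱ (<-trans b<i i<j) j≤b)
... | after _ _       | after _ _       = i<j

rotate-right-of-source : a < j → rotate a b j ≢ b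
rotate-right-of-source {j = zero} ()
rotate-right-of-source {a} {suc j} {b} a<j+1 with region a b (suc j)
... | before j+1<a   = ⊥-elim (<-asym a<j+1 j+1<a)
... | source j+1≡a   = ⊥-elim (<-irrefl (sym j+1≡a) a<j+1)
... | shifted _ j+1≤b = λ j≡b → <-irrefl j≡b j+1≤b
... | after _ b<j+1  = λ j+1≡b → <-irrefl (sym j+1≡b) b<j+1

rotate-non-ascent⇒source : a ≤ b → i < j → rotate a b j ≤ rotate a b i → i ≡ a
rotate-non-ascent⇒source a≤b i<j non-ascent =
  decidable-stable (_ ≟ _) (λ i≢a → <⇒≱ (rotate-increasing a≤b i<j i≢a) non-ascent)

rotate-inversion⇒source : a ≤ b → i < j → rotate a b j < rotate a b i → i ≡ a × a < b
rotate-inversion⇒source {a} {b} a≤b i<j descent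
  with rotate-non-ascent⇒source a≤b i<j (<⇒≤ descent)
... | refl with m≤n⇒m<n∨m≡n a≤b
...   | inj₁ a<b  = refl , a<b
...   | inj₂ refl = ⊥-elim (<-asym i<j (subst₂ _<_ (rotate-self {a}) (rotate-self {a}) descent))

rotate-no-tie : a ≤ b → i < j → rotate a b i ≢ rotate a b j
rotate-no-tie {a} {b} a≤b i<j eq with rotate-non-ascent⇒source a≤b i<j (≤-reflexive (sym eq))
... | refl = rotate-right-of-source i<j (trans (sym eq) (rotate-source {a} {b}))

rotate-injective : a ≤ b → rotate a b i ≡ rotate a b j → i ≡ j
rotate-injective {i = i} {j} a≤b eq with <-cmp i j
... | tri< i<j _ _ = ⊥-elim (rotate-no-tie a≤b i<j eq)
... | tri≈ _ i≡j _ = i≡j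
... | tri> _ _ j<i = ⊥-elim (rotate-no-tie a≤b j<i (sym eq))

InjectiveOn : ℕ → (ℕ → ℕ) → Set
InjectiveOn N g = ∀ {i j} → i < N → j < N → g i ≡ g j → i ≡ j

FishburnOn : ℕ → (ℕ → ℕ) → Set
FishburnOn N g = ∀ {i j} → i < j → j < N → g j < g i → g i < g (suc i) → g i ≡ g j + 1 → ⊥

Avoids321On : ℕ → (ℕ → ℕ) → Set
Avoids321On N g = ∀ {i j l} → i < j → j < l → l < N → g l < g j → g j < g i → ⊥

Avoids3142On : ℕ → (ℕ → ℕ) → Set
Avoids3142On N g =
  ∀ {i j l m} → i < j → j < l → l < m → m < N → g j < g m → g m < g i → g i < g l → ⊥

Avoids2143On : ℕ → (ℕ → ℕ) → Set
Avoids2143On N g =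
  ∀ {i j l m} → i < j → j < l → l < m → m < N → g j < g i → g i < g m → g m < g l → ⊥

GoodOn : ℕ → (ℕ → ℕ) → Set
GoodOn N g = InjectiveOn N g × FishburnOn N g × Avoids321On N g × Avoids3142On N g × Avoids2143On N g

EqualOn : ℕ → (ℕ → ℕ) → (ℕ → ℕ) → Set
EqualOn N g h = ∀ {i} → i < N → g i ≡ h i

rotate-good : a ≤ b → GoodOn N (rotate a b)
rotate-good {a} {b} a≤b =
  (λ _ _ → rotate-injective a≤b) , fishburn , avoids321 , avoids3142 , avoids2143
  where
  same-source : ∀ {i j l m} → i < j → rotate a b j < rotate a b i →
                l < m → rotate a b m < rotate a b l → i ≡ l
  same-source i<j ji l<m ml = trans (proj₁ (rotate-inversion⇒source a≤b i<j ji))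
                                   (sym (proj₁ (rotate-inversion⇒source a≤b l<m ml)))

  fishburn : FishburnOn _ (rotate a b)
  fishburn i<j _ descent ascent _ with rotate-inversion⇒source a≤b i<j descent
  ... | refl , a<b =
    <-asym a<b (subst₂ _<_ (rotate-source {a}) (rotate-shifted (n<1+n a) a<b) ascent)

  avoids321 : Avoids321On _ (rotate a b)
  avoids321 i<j j<l _ l<j j<i = <-irrefl (same-source i<j j<i j<l l<j) i<j

  avoids3142 : Avoids3142On _ (rotate a b)
  avoids3142 i<j j<l l<m _ j<m m<i i<l =
    <-irrefl (same-source i<j (<-trans j<m m<i) l<m (<-trans m<i i<l)) (<-trans i<j j<l)

  avoids2143 : Avoids2143On _ (rotate a b)
  avoids2143 i<j j<l l<m _ j<i i<m m<l = <-irrefl (same-source i<j j<i l<m m<l) (<-trans i<j j<l)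

pairs : ℕ → List (ℕ × ℕ)
pairs zero    = []ₗ
pairs (suc n) = map (_, n) (upTo n) ++ pairs n

∈-pairs⁻ : ∀ n → (a , b) ∈ pairs n → a < b × b < n
∈-pairs⁻ (suc n) ab∈ with ∈-++⁻ (map (_, n) (upTo n)) ab∈
... | inj₁ ab∈new with _ , a∈ , refl ← ∈-map⁻ (_, n) ab∈new = ∈-upTo⁻ a∈ , ≤-refl
... | inj₂ ab∈old with a<b , b<n ← ∈-pairs⁻ n ab∈old = a<b , m<n⇒m<1+n b<n

∈-pairs⁺ : ∀ n → a < b → b < n → (a , b) ∈ pairs n
∈-pairs⁺ (suc n) a<b b<1+n with m≤n⇒m<n∨m≡n (≤-pred b<1+n)
... | inj₁ b<n  = ∈-++⁺ʳ (map (_, n) (upTo n)) (∈-pairs⁺ n a<b b<n)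
... | inj₂ refl = ∈-++⁺ˡ (∈-map⁺ (_, n) (∈-upTo⁺ a<b))

pairs-unique : ∀ n → Unique (pairs n)
pairs-unique zero    = []
pairs-unique (suc n) =
  Unique.++⁺ (Unique.map⁺ (cong proj₁) (Unique.upTo⁺ n)) (pairs-unique n) disjoint
  where
  disjoint : ∀ {ab} → ¬ (ab ∈ map (_, n) (upTo n) × ab ∈ pairs n)
  disjoint (ab∈new , ab∈old) with _ , _ , refl ← ∈-map⁻ (_, n) ab∈new =
    <-irrefl refl (proj₂ (∈-pairs⁻ n ab∈old))

length-pairs : ∀ n → length (pairs n) ≡ n C 2
length-pairs zero    = refl
length-pairs (suc n) = begin
  length (map (_, n) (upTo n) ++ pairs n)         ≡⟨ length-++ (map (_, n) (upTo n)) ⟩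
  length (map (_, n) (upTo n)) + length (pairs n)
    ≡⟨ cong₂ _+_ (trans (length-map _ (upTo n)) (length-upTo n)) (length-pairs n) ⟩
  n + n C 2                                       ≡⟨ cong (_+ n C 2) (sym (nC1≡n n)) ⟩
  n C 1 + n C 2                                   ≡⟨ nCk+nC[k+1]≡[n+1]C[k+1] n 1 ⟩
  suc n C 2                                       ∎
  where open ≡-Reasoning

-- (0 , 0) stands for the identity, since rotate a a is the identity.
candidates : ℕ → List (ℕ × ℕ)
candidates N = (0 , 0) ∷ₗ pairs N

candidates-unique : ∀ N → Unique (candidates N)
candidates-unique N =
  All.tabulate (λ { ab∈ refl → <-irrefl refl (proj₁ (∈-pairs⁻ N ab∈)) }) ∷ pairs-unique N

candidate-ordered : (a , b) ∈ candidates N → a ≤ b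
candidate-ordered (here refl) = z≤n
candidate-ordered {N = N} (there ab∈) = <⇒≤ (proj₁ (∈-pairs⁻ N ab∈))

candidate-bounded : (a , b) ∈ candidates N → i < N → rotate a b i < N
candidate-bounded {a = a} (here refl) i<N = subst (_< _) (sym (rotate-self {a})) i<N
candidate-bounded {N = N} (there ab∈) = rotate-< (proj₂ (∈-pairs⁻ N ab∈))

private
  moved-source-≤ : ∀ {c d} → a < b → b < N → (c , d) ∈ candidates N →
                   EqualOn N (rotate a b) (rotate c d) → c ≤ a × c < d × d < N
  moved-source-≤ {a} {b} {N} {c} {d} a<b b<N cd∈ agree = from-candidate cd∈
    where
    moves-a : rotate c d a ≢ a
    moves-a fixes-a =
      <-irrefl (trans (sym fixes-a) (trans (sym (agree (<-trans a<b b<N))) (rotate-source {a} {b}))) a<b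
    from-candidate : (c , d) ∈ candidates N → c ≤ a × c < d × d < N
    from-candidate (here refl) = ⊥-elim (moves-a (rotate-self {0}))
    from-candidate (there cd∈) with a <? c
    ... | no  a≮c = ≮⇒≥ a≮c , ∈-pairs⁻ N cd∈
    ... | yes a<c = ⊥-elim (moves-a (rotate-before a<c))

rotate-injectiveOn-candidates : ∀ {c d} → (a , b) ∈ candidates N → (c , d) ∈ candidates N →
                                EqualOn N (rotate a b) (rotate c d) → (a , b) ≡ (c , d)
rotate-injectiveOn-candidates (here refl) (here refl) _ = refl
rotate-injectiveOn-candidates (here refl) (there cd∈) agree
  with c<d , d<N ← ∈-pairs⁻ _ cd∈
  with _ , 0<0 , _ ← moved-source-≤ c<d d<N (here refl) (sym ∘ agree) = ⊥-elim (<-irrefl refl 0<0)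
rotate-injectiveOn-candidates {a} {b} {c = c} {d} (there ab∈) cd∈ agree
  with a<b , b<N ← ∈-pairs⁻ _ ab∈
  with c≤a , c<d , d<N ← moved-source-≤ a<b b<N cd∈ agree
  with a≤c , _ ← moved-source-≤ c<d d<N (there ab∈) (sym ∘ agree)
  with refl ← ≤-antisym a≤c c≤a = cong (a ,_) (begin
    b            ≡⟨ rotate-source {a} {b} ⟨
    rotate a b a ≡⟨ agree (<-trans a<b b<N) ⟩
    rotate a d a ≡⟨ rotate-source {a} {d} ⟩
    d            ∎)
  where open ≡-Reasoning

module Characterisation {N : ℕ} {g : ℕ → ℕ}
  (injective   : InjectiveOn N g)
  (fishburn    : FishburnOn N g)
  (avoids321   : Avoids321On N g)
  (avoids3142  : Avoids3142On N g)
  (avoids2143  : Avoids2143On N g)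
  (bounded     : ∀ {i} → i < N → g i < N)
  (surjective  : ∀ {v} → v < N → ∃ λ i → i < N × g i ≡ v)
  where

  ascending : i < j → j < N → ¬ g j < g i → g i < g j
  ascending i<j j<N no-descent =
    ≤∧≢⇒< (≮⇒≥ no-descent) λ gi≡gj → <-irrefl (injective (<-trans i<j j<N) j<N gi≡gj) i<j

  comparable : i < N → j < N → i ≢ j → g i < g j ⊎ g j < g i
  comparable {i} {j} i<N j<N i≢j with <-cmp (g i) (g j)
  ... | tri< gi<gj _ _ = inj₁ gi<gj
  ... | tri≈ _ gi≡gj _ = ⊥-elim (i≢j (injective i<N j<N gi≡gj))
  ... | tri> _ _ gj<gi = inj₂ gj<gi

  module LastMoved {p k : ℕ} (p<k : p < k) (k<N : k < N) (gp≡k : g p ≡ k)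
                   (fixed : ∀ {i} → k < i → i < N → g i ≡ i) where

    p<N : p < N
    p<N = <-trans p<k k<N

    ≤k⇒<N : i ≤ k → i < N
    ≤k⇒<N i≤k = ≤-<-trans i≤k k<N

    below-k : i ≤ k → i ≢ p → g i < k
    below-k {i} i≤k i≢p with <-cmp (g i) k
    ... | tri< gi<k _ _ = gi<k
    ... | tri≈ _ gi≡k _ = ⊥-elim (i≢p (injective (≤k⇒<N i≤k) p<N (trans gi≡k (sym gp≡k))))
    ... | tri> _ _ k<gi = ⊥-elim (<⇒≱ (subst (k <_) gi≡i k<gi) i≤k)
      where
      i<N = ≤k⇒<N i≤k
      gi≡i : g i ≡ i
      gi≡i = injective (bounded i<N) i<N (fixed k<gi (bounded i<N))

    before-p-below-k : i < p → g i < k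
    before-p-below-k i<p = below-k (<⇒≤ (<-trans i<p p<k)) (<⇒≢ i<p)

    ascending-after-p : p < i → i < j → j ≤ k → g i < g j
    ascending-after-p p<i i<j j≤k = ascending i<j (≤k⇒<N j≤k) λ gj<gi →
      avoids321 p<i i<j (≤k⇒<N j≤k) gj<gi
        (subst (g _ <_) (sym gp≡k) (below-k (<⇒≤ (<-≤-trans i<j j≤k)) (>⇒≢ p<i)))

    ascending-before-p : i < j → j < p → g i < g j
    ascending-before-p {i} {j} i<j j<p = ascending i<j j<N descent-impossible
      where
      j<N = <-trans j<p p<N
      j<k = <-trans j<p p<k
      gk<gp : g k < g p
      gk<gp = subst (g k <_) (sym gp≡k) (below-k ≤-refl (>⇒≢ p<k))
      gi<gp : g i < g p
      gi<gp = subst (g i <_) (sym gp≡k) (before-p-below-k (<-trans i<j j<p))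
      descent-impossible : ¬ g j < g i
      descent-impossible gj<gi with comparable k<N j<N (>⇒≢ j<k)
      ... | inj₁ gk<gj = avoids321 i<j j<k k<N gk<gj gj<gi
      ... | inj₂ gj<gk with comparable k<N (<-trans i<j j<N) (>⇒≢ (<-trans i<j j<k))
      ...   | inj₁ gk<gi = avoids3142 i<j j<p p<k k<N gj<gk gk<gi gi<gp
      ...   | inj₂ gi<gk = avoids2143 i<j j<p p<k k<N gj<gi gi<gk gk<gp

    ascent-before-p : i < p → g i < g (suc i)
    ascent-before-p {i} i<p with m≤n⇒m<n∨m≡n i<p
    ... | inj₁ i+1<p = ascending-before-p (n<1+n i) i+1<p
    ... | inj₂ refl  = subst (g i <_) (sym gp≡k) (before-p-below-k i<p)

    no-descent-across-p : ∀ x {i j} → g i ≡ x → i < p → p < j → j ≤ k → ¬ g j < x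
    no-descent-across-p zero    _ _ _ _ ()
    no-descent-across-p (suc w) {i} {j} gi≡x i<p p<j j≤k gj<x = look-at (surjective w<N)
      where
      w<k : w < k
      w<k = <-trans (n<1+n w) (subst (_< k) gi≡x (before-p-below-k i<p))
      w<N = <-trans w<k k<N
      look-at : ∃ (λ q → q < N × g q ≡ w) → ⊥
      look-at (q , q<N , gq≡w) with <-cmp q p
      ... | tri< q<p _ _ = no-descent-across-p w gq≡w q<p p<j j≤k (≤∧≢⇒< (≤-pred gj<x) gj≢w)
        where
        gj≢w : g j ≢ w
        gj≢w gj≡w =
          <-asym q<p (subst (p <_) (injective (≤k⇒<N j≤k) q<N (trans gj≡w (sym gq≡w))) p<j)
      ... | tri≈ _ refl _ = <-irrefl (trans (sym gq≡w) gp≡k) w<k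
      ... | tri> _ _ p<q = fishburn (<-trans i<p p<q) q<N
            (subst₂ _<_ (sym gq≡w) (sym gi≡x) (n<1+n w)) (ascent-before-p i<p)
            (trans gi≡x (trans (+-comm 1 w) (cong (_+ 1) (sym gq≡w))))

    ascending-across-p : i < p → p < j → j ≤ k → g i < g j
    ascending-across-p i<p p<j j≤k =
      ascending (<-trans i<p p<j) (≤k⇒<N j≤k) (no-descent-across-p _ refl i<p p<j j≤k)

    ascending-off-p : i < j → j ≤ k → i ≢ p → j ≢ p → g i < g j
    ascending-off-p {i} {j} i<j j≤k i≢p j≢p with <-cmp j p
    ... | tri< j<p _ _  = ascending-before-p i<j j<p
    ... | tri≈ _ j≡p _ = ⊥-elim (j≢p j≡p)
    ... | tri> _ _ p<j with <-cmp i p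
    ...   | tri< i<p _ _  = ascending-across-p i<p p<j j≤k
    ...   | tri≈ _ i≡p _ = ⊥-elim (i≢p i≡p)
    ...   | tri> _ _ p<i  = ascending-after-p p<i i<j j≤k

    g∘skip-p≡id : i < k → g (skip p i) ≡ i
    g∘skip-p≡id = increasing-endo⇒id
      (λ {i} {j} i<j j<k →
        ascending-off-p (skip-< p i<j) (≤-trans (skip-≤ p j) j<k) (skip-≢ p i) (skip-≢ p j))
      (λ {i} i<k → below-k (≤-trans (skip-≤ p i) i<k) (skip-≢ p i))

    g≗rotate : EqualOn N g (rotate p k)
    g≗rotate {i} i<N with region p k i
    ... | before i<p     = trans (cong g (sym (skip-below i<p))) (g∘skip-p≡id (<-trans i<p p<k))
    ... | source refl    = gp≡k
    ... | after _ k<i    = fixed k<i i<N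
    g≗rotate {suc i} _ | shifted p<i+1 i+1≤k =
      trans (cong g (sym (skip-above (≤-pred p<i+1)))) (g∘skip-p≡id i+1≤k)

  IsRotation : Set
  IsRotation = ∃ λ ab → ab ∈ candidates N × EqualOn N g (uncurry rotate ab)

  is-rotation-fixing-from : ∀ k → k ≤ N → (∀ {i} → k ≤ i → i < N → g i ≡ i) → IsRotation
  is-rotation-fixing-from zero _ fixed =
    (0 , 0) , here refl , λ {i} i<N → trans (fixed z≤n i<N) (sym (rotate-self {0}))
  is-rotation-fixing-from (suc k) k<N fixed with g k ≟ k
  ... | yes gk≡k = is-rotation-fixing-from k (<⇒≤ k<N) fixed-from-k
    where
    fixed-from-k : ∀ {i} → k ≤ i → i < N → g i ≡ i
    fixed-from-k k≤i i<N with m≤n⇒m<n∨m≡n k≤i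
    ... | inj₁ k<i  = fixed k<i i<N
    ... | inj₂ refl = gk≡k
  ... | no gk≢k with p , p<N , gp≡k ← surjective k<N with <-cmp p k
  ...   | tri< p<k _ _  = (p , k) , there (∈-pairs⁺ N p<k k<N) , LastMoved.g≗rotate p<k k<N gp≡k fixed
  ...   | tri≈ _ refl _ = ⊥-elim (gk≢k gp≡k)
  ...   | tri> _ _ k<p  = ⊥-elim (<-irrefl (trans (sym gp≡k) (fixed k<p p<N)) k<p)

  is-rotation : IsRotation
  is-rotation = is-rotation-fixing-from N ≤-refl (λ N≤i i<N → ⊥-elim (<⇒≱ i<N N≤i))

record Represents {N : ℕ} (π : Vec (Fin N) N) (g : ℕ → ℕ) : Set where
  constructor represents
  field val-≡ : ∀ x → val π x ≡ g (toℕ x)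

open Represents

fishburn⇔fishburnOn : ∀ {N} {π : Vec (Fin N) N} {g : ℕ → ℕ} →
                      Represents π g → Fishburn π ⇔ FishburnOn N g
fishburn⇔fishburnOn {zero}          _   = mk⇔ (λ _ {_} {_} _ ()) (λ _ → tt)
fishburn⇔fishburnOn {suc m} {π} {g} (represents π≈g) = mk⇔ to from
  where
  at-inject₁ : ∀ x → val π (inject₁ x) ≡ g (toℕ x)
  at-inject₁ x = trans (π≈g (inject₁ x)) (cong g (toℕ-inject₁ x))

  to : Fishburn π → FishburnOn (suc m) g
  to fish {i} {j} i<j j<N gj<gi ascent gi≡gj+1 =
    fish x y (subst₂ _<_ (sym toℕx′) (sym (toℕ-fromℕ< j<N)) i<j)
      (subst₂ _<_ (sym πy) (sym πx′) gj<gi) (subst₂ _<_ (sym πx′) (sym πx+1) ascent)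
      (trans πx′ (trans gi≡gj+1 (cong (_+ 1) (sym πy))))
    where
    i<m = <-≤-trans i<j (≤-pred j<N)
    x = fromℕ< i<m
    y = fromℕ< j<N
    toℕx′ : toℕ (inject₁ x) ≡ i
    toℕx′ = trans (toℕ-inject₁ x) (toℕ-fromℕ< i<m)
    πx′ : val π (inject₁ x) ≡ g i
    πx′ = trans (at-inject₁ x) (cong g (toℕ-fromℕ< i<m))
    πx+1 : val π (fsuc x) ≡ g (suc i)
    πx+1 = trans (π≈g (fsuc x)) (cong (g ∘ suc) (toℕ-fromℕ< i<m))
    πy : val π y ≡ g j
    πy = trans (π≈g y) (cong g (toℕ-fromℕ< j<N))

  from : FishburnOn (suc m) g → Fishburn π
  from fish x y x′<y πy<πx′ πx′<πx+1 πx′≡πy+1 =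
    fish (subst (_< toℕ y) (toℕ-inject₁ x) x′<y) (toℕ<n y)
      (subst₂ _<_ (π≈g y) (at-inject₁ x) πy<πx′)
      (subst₂ _<_ (at-inject₁ x) (π≈g (fsuc x)) πx′<πx+1)
      (trans (sym (at-inject₁ x)) (trans πx′≡πy+1 (cong (_+ 1) (π≈g y))))

module _ {N : ℕ} {π : Vec (Fin N) N} {g : ℕ → ℕ} (π≈g : Represents π g) where

  represents-< : (i<N : i < N) → val π (fromℕ< i<N) ≡ g i
  represents-< i<N = trans (val-≡ π≈g _) (cong g (toℕ-fromℕ< i<N))

  represented-bounded : i < N → g i < N
  represented-bounded i<N = subst (_< N) (represents-< i<N) (toℕ<n _)

  represented-surjective : IsPerm N π → ∀ {v} → v < N → ∃ λ i → i < N × g i ≡ v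
  represented-surjective perm v<N with x , πx≡v ← injective⇒surjective perm (fromℕ< v<N) =
    toℕ x , toℕ<n x , trans (sym (val-≡ π≈g x)) (trans (cong toℕ πx≡v) (toℕ-fromℕ< v<N))

  isPerm⇔injectiveOn : IsPerm N π ⇔ InjectiveOn N g
  isPerm⇔injectiveOn = mk⇔ to from
    where
    to : IsPerm N π → InjectiveOn N g
    to perm i<N j<N gi≡gj = begin
      _                      ≡⟨ toℕ-fromℕ< i<N ⟨
      toℕ (fromℕ< i<N)       ≡⟨ cong toℕ (perm (toℕ-injective πᵢ≡πⱼ)) ⟩
      toℕ (fromℕ< j<N)       ≡⟨ toℕ-fromℕ< j<N ⟩
      _                      ∎
      where
      open ≡-Reasoning
      πᵢ≡πⱼ = trans (represents-< i<N) (trans gi≡gj (sym (represents-< j<N)))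
    from : InjectiveOn N g → IsPerm N π
    from injective {x} {y} πx≡πy =
      toℕ-injective (injective (toℕ<n x) (toℕ<n y)
        (trans (sym (val-≡ π≈g x)) (trans (cong toℕ πx≡πy) (val-≡ π≈g y))))

  -- vs lists the values of the occurrence in increasing order, so the entry at pos[x] is vs[p[x]].
  contains-occurrence : ∀ {k} (p : Vec (Fin k) k) (pos vs : Vec ℕ k) →
                        Ascending pos → AllV (_< N) pos → Ascending vs →
                        Vec.map g pos ≡ Vec.map (lookup vs) p → Contains π p
  contains-occurrence {k} p pos vs pos↗ pos<N vs↗ shape = f , increasing , order-iso
    where
    f : Fin k → Fin N
    f x = fromℕ< (AllV.lookup⁺ pos<N x)
    toℕ-f : ∀ x → toℕ (f x) ≡ lookup pos x
    toℕ-f x = toℕ-fromℕ< (AllV.lookup⁺ pos<N x)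
    val-f : ∀ x → val π (f x) ≡ lookup vs (lookup p x)
    val-f x = begin
      val π (f x)                      ≡⟨ represents-< (AllV.lookup⁺ pos<N x) ⟩
      g (lookup pos x)                 ≡⟨ lookup-map x g pos ⟨
      lookup (Vec.map g pos) x         ≡⟨ cong (λ v → lookup v x) shape ⟩
      lookup (Vec.map (lookup vs) p) x ≡⟨ lookup-map x (lookup vs) p ⟩
      lookup vs (lookup p x)           ∎
      where open ≡-Reasoning
    increasing : ∀ x y → toℕ x < toℕ y → toℕ (f x) < toℕ (f y)
    increasing x y x<y =
      subst₂ _<_ (sym (toℕ-f x)) (sym (toℕ-f y)) (Linked.lookup⁺ <-trans pos↗ x<y)
    order-iso : ∀ x y → (val π (f x) < val π (f y)) ⇔ (toℕ (lookup p x) < toℕ (lookup p y))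
    order-iso x y = subst₂ (λ u v → (u < v) ⇔ _) (sym (val-f x)) (sym (val-f y)) (lookup-<⇔ vs↗)

  occurrence : ∀ {k} (p : Vec (Fin k) k) → Contains π p →
               ∃ λ (pos : Fin k → ℕ) → (∀ x → pos x < N) ×
                 (∀ x y → toℕ x < toℕ y → pos x < pos y) ×
                 (∀ x y → toℕ (lookup p x) < toℕ (lookup p y) → g (pos x) < g (pos y))
  occurrence p (f , increasing , order-iso) =
    toℕ ∘ f , toℕ<n ∘ f , increasing ,
    λ x y px<py →
      subst₂ _<_ (val-≡ π≈g (f x)) (val-≡ π≈g (f y)) (Equivalence.from (order-iso x y) px<py)

  avoids321⇔ : Avoids π p321 ⇔ Avoids321On N g
  avoids321⇔ = mk⇔ to from
    where
    to : Avoids π p321 → Avoids321On N g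
    to avoids {i} {j} {l} i<j j<l l<N gl<gj gj<gi = avoids
      (contains-occurrence p321 (i ∷ j ∷ l ∷ []) (g l ∷ g j ∷ g i ∷ [])
        (i<j ∷ j<l ∷ [-]) (<-trans i<j j<N ∷ j<N ∷ l<N ∷ []) (gl<gj ∷ gj<gi ∷ [-])
        refl)
      where j<N = <-trans j<l l<N
    from : Avoids321On N g → Avoids π p321
    from avoids321 occ with pos , pos<N , increasing , ordered ← occurrence p321 occ =
      avoids321 (increasing (# 0) (# 1) ≤-refl) (increasing (# 1) (# 2) ≤-refl) (pos<N (# 2))
                (ordered (# 2) (# 1) ≤-refl) (ordered (# 1) (# 0) ≤-refl)

  avoids3142⇔ : Avoids π p3142 ⇔ Avoids3142On N g
  avoids3142⇔ = mk⇔ to from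
    where
    to : Avoids π p3142 → Avoids3142On N g
    to avoids {i} {j} {l} {m} i<j j<l l<m m<N gj<gm gm<gi gi<gl = avoids
      (contains-occurrence p3142 (i ∷ j ∷ l ∷ m ∷ []) (g j ∷ g m ∷ g i ∷ g l ∷ [])
        (i<j ∷ j<l ∷ l<m ∷ [-]) (<-trans i<j j<N ∷ j<N ∷ l<N ∷ m<N ∷ [])
        (gj<gm ∷ gm<gi ∷ gi<gl ∷ [-])
        refl)
      where
      l<N = <-trans l<m m<N
      j<N = <-trans j<l l<N
    from : Avoids3142On N g → Avoids π p3142
    from avoids3142 occ with pos , pos<N , increasing , ordered ← occurrence p3142 occ =
      avoids3142 (increasing (# 0) (# 1) ≤-refl) (increasing (# 1) (# 2) ≤-refl)
                 (increasing (# 2) (# 3) ≤-refl) (pos<N (# 3))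
                 (ordered (# 1) (# 3) ≤-refl) (ordered (# 3) (# 0) ≤-refl) (ordered (# 0) (# 2) ≤-refl)

  avoids2143⇔ : Avoids π p2143 ⇔ Avoids2143On N g
  avoids2143⇔ = mk⇔ to from
    where
    to : Avoids π p2143 → Avoids2143On N g
    to avoids {i} {j} {l} {m} i<j j<l l<m m<N gj<gi gi<gm gm<gl = avoids
      (contains-occurrence p2143 (i ∷ j ∷ l ∷ m ∷ []) (g j ∷ g i ∷ g m ∷ g l ∷ [])
        (i<j ∷ j<l ∷ l<m ∷ [-]) (<-trans i<j j<N ∷ j<N ∷ l<N ∷ m<N ∷ [])
        (gj<gi ∷ gi<gm ∷ gm<gl ∷ [-])
        refl)
      where
      l<N = <-trans l<m m<N
      j<N = <-trans j<l l<N
    from : Avoids2143On N g → Avoids π p2143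
    from avoids2143 occ with pos , pos<N , increasing , ordered ← occurrence p2143 occ =
      avoids2143 (increasing (# 0) (# 1) ≤-refl) (increasing (# 1) (# 2) ≤-refl)
                 (increasing (# 2) (# 3) ≤-refl) (pos<N (# 3))
                 (ordered (# 1) (# 0) ≤-refl) (ordered (# 0) (# 3) ≤-refl) (ordered (# 3) (# 2) ≤-refl)

  good⇔goodOn : Good N π ⇔ GoodOn N g
  good⇔goodOn = isPerm⇔injectiveOn ×-⇔ fishburn⇔fishburnOn π≈g ×-⇔
                avoids321⇔ ×-⇔ avoids3142⇔ ×-⇔ avoids2143⇔

represented-≡ : ∀ {N} {π σ : Vec (Fin N) N} {g h : ℕ → ℕ} →
                Represents π g → Represents σ h → EqualOn N g h → π ≡ σ
represented-≡ {π = π} {σ} (represents π≈g) (represents σ≈h) g≗h = begin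
  π                       ≡⟨ tabulate∘lookup π ⟨
  tabulate (lookup π)     ≡⟨ tabulate-cong (λ x → toℕ-injective (πₓ≡σₓ x)) ⟩
  tabulate (lookup σ)     ≡⟨ tabulate∘lookup σ ⟩
  σ                       ∎
  where
  open ≡-Reasoning
  πₓ≡σₓ : ∀ x → val π x ≡ val σ x
  πₓ≡σₓ x = trans (π≈g x) (trans (g≗h (toℕ<n x)) (sym (σ≈h x)))

represented-equalOn : ∀ {N} {π : Vec (Fin N) N} {g h : ℕ → ℕ} →
                      Represents π g → Represents π h → EqualOn N g h
represented-equalOn π≈g π≈h i<N =
  trans (sym (represents-< π≈g i<N)) (represents-< π≈h i<N)

entries : ∀ {N} → Vec (Fin N) N → ℕ → ℕ
entries {N} π i with i <? N
... | yes i<N = val π (fromℕ< i<N)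
... | no  _   = i

entries-represents : ∀ {N} (π : Vec (Fin N) N) → Represents π (entries π)
entries-represents {N} π = represents at
  where
  at : ∀ x → val π x ≡ entries π (toℕ x)
  at x with toℕ x <? N
  ... | yes x<N = cong (val π) (sym (fromℕ<-toℕ x x<N))
  ... | no  x≮N = ⊥-elim (x≮N (toℕ<n x))

fromℕ-or : ∀ {N} → Fin N → ℕ → Fin N
fromℕ-or {N} default v with v <? N
... | yes v<N = fromℕ< v<N
... | no  _   = default

toℕ-fromℕ-or : ∀ {N} (default : Fin N) {v} → v < N → toℕ (fromℕ-or default v) ≡ v
toℕ-fromℕ-or {N} default {v} v<N with v <? N
... | yes v<N′ = toℕ-fromℕ< v<N′
... | no  v≮N  = ⊥-elim (v≮N v<N)

fromFunction : (N : ℕ) → (ℕ → ℕ) → Vec (Fin N) N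
fromFunction N g = tabulate (λ x → fromℕ-or x (g (toℕ x)))

fromFunction-represents : ∀ {N g} → (∀ {i} → i < N → g i < N) → Represents (fromFunction N g) g
fromFunction-represents {N} {g} bounded = represents λ x →
  trans (cong toℕ (lookup∘tabulate _ x)) (toℕ-fromℕ-or x (bounded (toℕ<n x)))

rotation : (N : ℕ) → ℕ × ℕ → Vec (Fin N) N
rotation N (a , b) = fromFunction N (rotate a b)

rotation-represents : ∀ {ab} → ab ∈ candidates N → Represents (rotation N ab) (uncurry rotate ab)
rotation-represents ab∈ = fromFunction-represents (candidate-bounded ab∈)

rotation-good : ∀ {ab} → ab ∈ candidates N → Good N (rotation N ab)
rotation-good {N} ab∈ =
  Equivalence.from (good⇔goodOn (rotation-represents ab∈)) (rotate-good (candidate-ordered {N = N} ab∈))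

rotation-injective : ∀ {ab cd} → ab ∈ candidates N → cd ∈ candidates N →
                     rotation N ab ≡ rotation N cd → ab ≡ cd
rotation-injective ab∈ cd∈ eq =
  rotate-injectiveOn-candidates ab∈ cd∈
    (represented-equalOn (rotation-represents ab∈)
                         (subst (λ σ → Represents σ _) (sym eq) (rotation-represents cd∈)))

good⇒rotation : ∀ {N} {π : Vec (Fin N) N} → Good N π →
                ∃ λ ab → ab ∈ candidates N × π ≡ rotation N ab
good⇒rotation {N} {π} good
  with injective , fishburn , avoids321 , avoids3142 , avoids2143
         ← Equivalence.to (good⇔goodOn (entries-represents π)) good
  with ab , ab∈ , entries≗rotate
         ← Characterisation.is-rotation injective fishburn avoids321 avoids3142 avoids2143
             (represented-bounded (entries-represents π))
             (represented-surjective (entries-represents π) (proj₁ good))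
  = ab , ab∈ , represented-≡ (entries-represents π) (rotation-represents ab∈) entries≗rotate

theorem3p4 : (n : ℕ) → HasCount (Good n) ((n C 2) + 1)
theorem3p4 n = map (rotation n) (candidates n) , unique , members , counted
  where
  unique : Unique (map (rotation n) (candidates n))
  unique = unique-map⁺ (rotation n) rotation-injective (candidates-unique n)
  members : ∀ π → (π ∈ map (rotation n) (candidates n)) ⇔ Good n π
  members π = mk⇔ sound complete
    where
    sound : π ∈ map (rotation n) (candidates n) → Good n π
    sound π∈ = let _ , ab∈ , π≡ = ∈-map⁻ (rotation n) π∈ in
      subst (Good n) (sym π≡) (rotation-good ab∈)
    complete : Good n π → π ∈ map (rotation n) (candidates n)
    complete good = let _ , ab∈ , π≡ = good⇒rotation good in
      subst (_∈ _) (sym π≡) (∈-map⁺ (rotation n) ab∈)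
  counted : length (map (rotation n) (candidates n)) ≡ n C 2 + 1
  counted = begin
    length (map (rotation n) (candidates n)) ≡⟨ length-map (rotation n) (candidates n) ⟩
    suc (length (pairs n))                   ≡⟨ cong suc (length-pairs n) ⟩
    suc (n C 2)                              ≡⟨ +-comm 1 (n C 2) ⟩
    n C 2 + 1                                ∎
    where open ≡-Reasoning
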